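{- For all $\pi\mathrm{BI}$ processes $P,Q$, if $P\equiv Q$ then $\mathrm{an}(P)=\mathrm{an}(Q)$.
   Context: Processes: $P,Q ::= \overline{x}[y].(P \mid Q)\mid x(y).P\mid\overline{x}[\,]\mid x().P\mid x\triangleleft\mathsf{inl}.P\mid x\triangleleft\mathsf{inr}.P\mid x\triangleright\{\mathsf{inl}:P,\mathsf{inr}:Q\}\mid[x\leftarrow y]\mid(\nu x)(P\mid Q)\mid\mathsf{spawn}[\sigma].P$, where a spawn binding $\sigma$ is a finite partial function from names to finite sets of names with $\sigma(x)\cap\sigma(y)=\emptyset$ for distinct $x,y\in\mathrm{dom}\sigma$ and $\mathrm{dom}\sigma\cap\sigma(x)=\emptyset$; $\mathrm{restr}(\sigma)=\mathrm{rng}(\sigma)=\bigcup_x\sigma(x)$. Binders: $y$ in output/input, $x$ in restriction, names in $\mathrm{restr}(\sigma)$ in $\mathsf{spawn}[\sigma].P$; $\mathrm{fn}(\mathsf{spawn}[\sigma].P)=(\mathrm{fn}(P)\setminus\mathrm{restr}\sigma)\cup\mathrm{dom}\sigma$. Processes are up to $\alpha$-conversion. $\sigma_1,\sigma_2$ independent means $\mathrm{dom}\sigma_1\cap\mathrm{dom}\sigma_2$, $\mathrm{dom}\sigma_1\cap\mathrm{restr}\sigma_2$, $\mathrm{restr}\sigma_1\cap\mathrm{restr}\sigma_2$, $\mathrm{dom}\sigma_2\cap\mathrm{restr}\sigma_1$ are empty. Structural congruence $\equiv$: smallest congruence with $(\nu x)(P\mid(\nu y)(Q\mid R))\equiv(\nu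 y)(Q\mid(\nu x)(P\mid R))$ when $x\notin\mathrm{fn}(Q),y\notin\mathrm{fn}(P)$; $(\nu x)(P\mid(\nu y)(Q\mid R))\equiv(\nu y)((\nu x)(P\mid Q)\mid R)$ when $x\notin\mathrm{fn}(R),y\notin\mathrm{fn}(P)$; $\mathsf{spawn}[\sigma_1].\mathsf{spawn}[\sigma_2].Q\equiv\mathsf{spawn}[\sigma_2].\mathsf{spawn}[\sigma_1].Q$ when $\sigma_1,\sigma_2$ are independent. Active names: $\mathrm{an}(\overline{x}[\,])=\mathrm{an}(x().P)=\mathrm{an}(\overline{x}[y].(P\mid Q))=\mathrm{an}(x(y).P)=\mathrm{an}(x\triangleleft\mathsf{inl}.P)=\mathrm{an}(x\triangleleft\mathsf{inr}.P)=\mathrm{an}(x\triangleright\{\mathsf{inl}:P,\mathsf{inr}:Q\})=\{x\}$; $\mathrm{an}([x\leftarrow y])=\{x,y\}$; $\mathrm{an}((\nu x)(P\mid Q))=(\mathrm{an}(P)\cup\mathrm{an}(Q))\setminus\{x\}$; $\mathrm{an}(\mathsf{spawn}[\sigma].P)=\mathrm{dom}(\sigma)\cup(\mathrm{an}(P)\setminus\mathrm{rng}(\sigma))$. -}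

module Defs where

open import Data.Nat using (ℕ; _≟_)
open import Data.List using (List; []; _∷_; _++_; filter; map; concatMap)
open import Data.List.Membership.Propositional using (_∈_; _∉_)
open import Data.Product using (_×_; _,_; proj₁; proj₂)
open import Relation.Nullary using (¬_; yes; no)
open import Relation.Nullary.Decidable using (¬?)
open import Relation.Binary.PropositionalEquality using (_≡_)
open import Data.List.Membership.DecPropositional _≟_ using (_∈?_)

Name : Set
Name = ℕ

-- A spawn binding σ : finite partial function from names to finite sets of
-- names, represented as an association list (x , σ(x)); finite sets as lists.
Binding : Set
Binding = List (Name × List Name)

dom : Binding → List Name
dom σ = map proj₁ σ

restr : Binding → List Name
restr σ = concatMap proj₂ σ

rng : Binding → List Name
rng = restr

data DistinctKeys : Binding → Set where
  dk-nil  : DistinctKeys []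
  dk-cons : ∀ {x s σ} → x ∉ dom σ → DistinctKeys σ → DistinctKeys ((x , s) ∷ σ)

ValidBinding : Binding → Set
ValidBinding σ =
  DistinctKeys σ
  × (∀ x y sx sy → (x , sx) ∈ σ → (y , sy) ∈ σ → ¬ (x ≡ y) → ∀ z → z ∈ sx → z ∉ sy)
  × (∀ z → z ∈ dom σ → z ∉ restr σ)

Independent : Binding → Binding → Set
Independent σ₁ σ₂ =
  (∀ z → z ∈ dom σ₁ → z ∉ dom σ₂)
  × (∀ z → z ∈ dom σ₁ → z ∉ restr σ₂)
  × (∀ z → z ∈ restr σ₁ → z ∉ restr σ₂)
  × (∀ z → z ∈ dom σ₂ → z ∉ restr σ₁)

data Proc : Set where
  out    : Name → Name → Proc → Proc → Proc   -- x̄[y].(P | Q)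
  inp    : Name → Name → Proc → Proc          -- x(y).P
  close  : Name → Proc
  wait   : Name → Proc → Proc
  selL   : Name → Proc → Proc
  selR   : Name → Proc → Proc
  branch : Name → Proc → Proc → Proc          -- x ▷ {inl:P, inr:Q}
  fwd    : Name → Name → Proc                 -- [x ← y]
  new    : Name → Proc → Proc → Proc          -- (νx)(P | Q)
  spawn  : Binding → Proc → Proc              -- spawn[σ].P

_∖_ : List Name → List Name → List Name
xs ∖ ys = filter (λ z → ¬? (z ∈? ys)) xs

_─_ : List Name → Name → List Name
xs ─ y = filter (λ z → ¬? (z ≟ y)) xs

-- Free names. Reading: in x̄[y].(P | Q) the name y is bound in P only.
fn : Proc → List Name
fn (out x y P Q)    = x ∷ ((fn P ─ y) ++ fn Q)
fn (inp x y P)      = x ∷ (fn P ─ y)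
fn (close x)        = x ∷ []
fn (wait x P)       = x ∷ fn P
fn (selL x P)       = x ∷ fn P
fn (selR x P)       = x ∷ fn P
fn (branch x P Q)   = x ∷ (fn P ++ fn Q)
fn (fwd x y)        = x ∷ y ∷ []
fn (new x P Q)      = (fn P ++ fn Q) ─ x
fn (spawn σ P)      = (fn P ∖ restr σ) ++ dom σ

an : Proc → List Name
an (out x y P Q)    = x ∷ []
an (inp x y P)      = x ∷ []
an (close x)        = x ∷ []
an (wait x P)       = x ∷ []
an (selL x P)       = x ∷ []
an (selR x P)       = x ∷ []
an (branch x P Q)   = x ∷ []
an (fwd x y)        = x ∷ y ∷ []
an (new x P Q)      = (an P ++ an Q) ─ x
an (spawn σ P)      = dom σ ++ (an P ∖ rng σ)

data WF : Proc → Set where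
  wf-out    : ∀ {x y P Q} → WF P → WF Q → WF (out x y P Q)
  wf-inp    : ∀ {x y P} → WF P → WF (inp x y P)
  wf-close  : ∀ {x} → WF (close x)
  wf-wait   : ∀ {x P} → WF P → WF (wait x P)
  wf-selL   : ∀ {x P} → WF P → WF (selL x P)
  wf-selR   : ∀ {x P} → WF P → WF (selR x P)
  wf-branch : ∀ {x P Q} → WF P → WF Q → WF (branch x P Q)
  wf-fwd    : ∀ {x y} → WF (fwd x y)
  wf-new    : ∀ {x P Q} → WF P → WF Q → WF (new x P Q)
  wf-spawn  : ∀ {σ P} → ValidBinding σ → WF P → WF (spawn σ P)

swapN : Name → Name → Name → Name
swapN a b z with z ≟ a
... | yes _ = b
... | no _ with z ≟ b
...   | yes _ = a
...   | no _ = z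

swapB : Name → Name → Binding → Binding
swapB a b σ = map (λ p → swapN a b (proj₁ p) , map (swapN a b) (proj₂ p)) σ

-- swap only the ranges (the bound names) of a binding
swapRng : Name → Name → Binding → Binding
swapRng a b σ = map (λ p → proj₁ p , map (swapN a b) (proj₂ p)) σ

swapP : Name → Name → Proc → Proc
swapP a b (out x y P Q)  = out (swapN a b x) (swapN a b y) (swapP a b P) (swapP a b Q)
swapP a b (inp x y P)    = inp (swapN a b x) (swapN a b y) (swapP a b P)
swapP a b (close x)      = close (swapN a b x)
swapP a b (wait x P)     = wait (swapN a b x) (swapP a b P)
swapP a b (selL x P)     = selL (swapN a b x) (swapP a b P)
swapP a b (selR x P)     = selR (swapN a b x) (swapP a b P)
swapP a b (branch x P Q) = branch (swapN a b x) (swapP a b P) (swapP a b Q)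
swapP a b (fwd x y)      = fwd (swapN a b x) (swapN a b y)
swapP a b (new x P Q)    = new (swapN a b x) (swapP a b P) (swapP a b Q)
swapP a b (spawn σ P)    = spawn (swapB a b σ) (swapP a b P)

-- Structural congruence (processes are taken up to α-conversion, so the
-- α-renaming of each binder is included as a generating rule).
infix 4 _≡s_
data _≡s_ : Proc → Proc → Set where
  s-refl  : ∀ {P} → P ≡s P
  s-sym   : ∀ {P Q} → P ≡s Q → Q ≡s P
  s-trans : ∀ {P Q R} → P ≡s Q → Q ≡s R → P ≡s R
  c-out    : ∀ {x y P P' Q Q'} → P ≡s P' → Q ≡s Q' → out x y P Q ≡s out x y P' Q'
  c-inp    : ∀ {x y P P'} → P ≡s P' → inp x y P ≡s inp x y P'
  c-wait   : ∀ {x P P'} → P ≡s P' → wait x P ≡s wait x P'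
  c-selL   : ∀ {x P P'} → P ≡s P' → selL x P ≡s selL x P'
  c-selR   : ∀ {x P P'} → P ≡s P' → selR x P ≡s selR x P'
  c-branch : ∀ {x P P' Q Q'} → P ≡s P' → Q ≡s Q' → branch x P Q ≡s branch x P' Q'
  c-new    : ∀ {x P P' Q Q'} → P ≡s P' → Q ≡s Q' → new x P Q ≡s new x P' Q'
  c-spawn  : ∀ {σ P P'} → P ≡s P' → spawn σ P ≡s spawn σ P'
  ax-nu1 : ∀ {x y P Q R} → x ∉ fn Q → y ∉ fn P →
           new x P (new y Q R) ≡s new y Q (new x P R)
  ax-nu2 : ∀ {x y P Q R} → x ∉ fn R → y ∉ fn P →
           new x P (new y Q R) ≡s new y (new x P Q) R
  ax-spawn : ∀ {σ₁ σ₂ Q} → Independent σ₁ σ₂ →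
           spawn σ₁ (spawn σ₂ Q) ≡s spawn σ₂ (spawn σ₁ Q)
  α-out : ∀ {x y z P Q} → z ∉ fn P →
          out x y P Q ≡s out x z (swapP y z P) Q
  α-inp : ∀ {x y z P} → z ∉ fn P →
          inp x y P ≡s inp x z (swapP y z P)
  α-new : ∀ {x z P Q} → z ∉ fn P → z ∉ fn Q →
          new x P Q ≡s new z (swapP x z P) (swapP x z Q)
  α-spawn : ∀ {σ a b P} → a ∈ restr σ → b ∉ fn P → b ∉ dom σ → b ∉ restr σ →
          spawn σ P ≡s spawn (swapRng a b σ) (swapP a b P)

-- Each structural axiom either leaves the active names untouched (prefixes, α-renaming
-- of input/output binders) or rearranges the filters that compute them: ν-exchange and
-- spawn-exchange commute two name removals, and their side conditions say that a
-- removal is vacuous on the component it is moved past. For α-renaming of a restriction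
-- or of a spawn binding one uses equivariance, an (swapP a b P) = swap a b · an P, and
-- the freshness of the new name, which makes the swap act trivially on what survives.
module Submission where

open import Defs
open import Data.Product using (_×_)
open import Data.List.Membership.Propositional using (_∈_)

open import Data.Nat using (_≟_)
open import Data.Empty using (⊥-elim)
open import Data.List.Membership.DecPropositional _≟_ using (_∈?_)
open import Data.Product using (_,_; proj₁; proj₂)
open import Data.Sum using ([_,_])
open import Data.List using (List; []; _∷_; _++_; filter; map)
open import Data.List.Properties using (++-assoc; filter-++; filter-all; map-++; map-id-local; map-∘)
open import Data.List.Membership.Propositional using (_∉_)
open import Data.List.Membership.Propositional.Properties
  using (∈-filter⁺; ∈-filter⁻; ∈-map⁺; ∈-map⁻; ∈-++⁻)
open import Data.List.Relation.Unary.All using (tabulate)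
open import Data.List.Relation.Binary.Subset.Propositional using (_⊆_)
open import Data.List.Relation.Binary.Subset.Propositional.Properties
  using (⊆-trans; ⊆-reflexive-↭; xs⊆xs++ys; ++⁺; ++⁺ʳ; filter⁺′)
open import Data.List.Relation.Binary.Permutation.Propositional.Properties using (++-comm; shifts)
open import Data.List.Relation.Binary.BagAndSetEquality
  using (_∼[_]_; set; [_]-Equality; ++-cong; bag-=⇒; ↭⇒∼bag)
open import Function using (_∘_; id)
open import Function.Bundles using (mk⇔; Equivalence)
open import Function.Definitions using (Injective)
open import Level using (Level)
open import Relation.Nullary using (yes; no)
open import Relation.Nullary.Decidable using (¬?)
open import Relation.Unary using (Pred; Decidable)
open import Relation.Binary.Bundles using (Setoid)
open import Relation.Binary.PropositionalEquality using (_≡_; _≢_; refl; sym; trans; cong; cong₂)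
import Relation.Binary.Reasoning.Setoid as SetoidReasoning

private
  variable
    ℓ ℓ′ p q : Level
    A : Set ℓ
    B : Set ℓ′

module _ {A : Set ℓ} where
  open Setoid ([ set ]-Equality A) public
    using () renaming (refl to ∼-refl; sym to ∼-sym; trans to ∼-trans)

  filter-cong : ∀ {P : Pred A p} (P? : Decidable P) {xs ys : List A} →
                xs ∼[ set ] ys → filter P? xs ∼[ set ] filter P? ys
  filter-cong P? xs∼ys =
    mk⇔ (filter⁺′ P? P? id (Equivalence.to xs∼ys)) (filter⁺′ P? P? id (Equivalence.from xs∼ys))

  filter-swap-⊆ : ∀ {P : Pred A p} {Q : Pred A q} (P? : Decidable P) (Q? : Decidable Q) xs →
                  filter P? (filter Q? xs) ⊆ filter Q? (filter P? xs)
  filter-swap-⊆ P? Q? xs v∈ with ∈-filter⁻ P? {xs = filter Q? xs} v∈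
  ... | v∈Qxs , pv with ∈-filter⁻ Q? {xs = xs} v∈Qxs
  ...   | v∈xs , qv = ∈-filter⁺ Q? (∈-filter⁺ P? v∈xs pv) qv

  filter-comm : ∀ {P : Pred A p} {Q : Pred A q} (P? : Decidable P) (Q? : Decidable Q) xs →
                filter P? (filter Q? xs) ∼[ set ] filter Q? (filter P? xs)
  filter-comm P? Q? xs = mk⇔ (filter-swap-⊆ P? Q? xs) (filter-swap-⊆ Q? P? xs)

  ++-congʳ : ∀ zs {xs ys : List A} → xs ∼[ set ] ys → zs ++ xs ∼[ set ] zs ++ ys
  ++-congʳ zs = ++-cong (∼-refl {x = zs})

  ++-leftComm : ∀ (xs ys : List A) {zs} → xs ++ ys ++ zs ∼[ set ] ys ++ xs ++ zs
  ++-leftComm xs ys = bag-=⇒ (↭⇒∼bag (shifts xs ys))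

map-filter : ∀ {P : Pred A p} {Q : Pred B q} (P? : Decidable P) (Q? : Decidable Q)
             (f : A → B) → (∀ {x} → P x → Q (f x)) → (∀ {x} → Q (f x) → P x) →
             ∀ xs → map f (filter P? xs) ∼[ set ] filter Q? (map f xs)
map-filter P? Q? f P⇒Q Q⇒P xs = mk⇔ to from
  where
  to : map f (filter P? xs) ⊆ filter Q? (map f xs)
  to w∈ with ∈-map⁻ f w∈
  ... | v , v∈ , refl with ∈-filter⁻ P? {xs = xs} v∈
  ...   | v∈xs , pv = ∈-filter⁺ Q? (∈-map⁺ f v∈xs) (P⇒Q pv)
  from : filter Q? (map f xs) ⊆ map f (filter P? xs)
  from w∈ with ∈-filter⁻ Q? {xs = map f xs} w∈
  ... | w∈fxs , qw with ∈-map⁻ f w∈fxs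
  ...   | v , v∈xs , refl = ∈-map⁺ f (∈-filter⁺ P? v∈xs (Q⇒P qw))

─-fresh : ∀ {y} xs → y ∉ xs → xs ─ y ≡ xs
─-fresh {y} xs y∉xs = filter-all (λ z → ¬? (z ≟ y)) (tabulate λ { z∈xs refl → y∉xs z∈xs })

∖-fresh : ∀ xs ys → (∀ z → z ∈ xs → z ∉ ys) → xs ∖ ys ≡ xs
∖-fresh xs ys disjoint = filter-all (λ z → ¬? (z ∈? ys)) (tabulate (disjoint _))

─-++-freshˡ : ∀ {y} xs ys → y ∉ xs → (xs ++ ys) ─ y ≡ xs ++ ys ─ y
─-++-freshˡ {y} xs ys y∉xs =
  trans (filter-++ (λ z → ¬? (z ≟ y)) xs ys) (cong (_++ ys ─ y) (─-fresh xs y∉xs))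

─-++-freshʳ : ∀ {y} xs ys → y ∉ ys → (xs ++ ys) ─ y ≡ xs ─ y ++ ys
─-++-freshʳ {y} xs ys y∉ys =
  trans (filter-++ (λ z → ¬? (z ≟ y)) xs ys) (cong (xs ─ y ++_) (─-fresh ys y∉ys))

─-comm : ∀ xs x y → (xs ─ y) ─ x ∼[ set ] (xs ─ x) ─ y
─-comm xs x y = filter-comm (λ z → ¬? (z ≟ x)) (λ z → ¬? (z ≟ y)) xs

∖-comm : ∀ xs ys zs → (xs ∖ ys) ∖ zs ∼[ set ] (xs ∖ zs) ∖ ys
∖-comm xs ys zs = filter-comm (λ z → ¬? (z ∈? zs)) (λ z → ¬? (z ∈? ys)) xs

map-─ : ∀ {f : Name → Name} → Injective _≡_ _≡_ f → ∀ xs y → map f (xs ─ y) ∼[ set ] map f xs ─ f y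
map-─ {f} f-inj xs y =
  map-filter (λ z → ¬? (z ≟ y)) (λ z → ¬? (z ≟ f y)) f (λ z≢y → z≢y ∘ f-inj) (λ fz≢fy → fz≢fy ∘ cong f) xs

map-∖ : ∀ {f : Name → Name} → Injective _≡_ _≡_ f → ∀ xs ys → map f (xs ∖ ys) ∼[ set ] map f xs ∖ map f ys
map-∖ {f} f-inj xs ys =
  map-filter (λ z → ¬? (z ∈? ys)) (λ z → ¬? (z ∈? map f ys)) f reflect (λ fz∉ z∈ → fz∉ (∈-map⁺ f z∈)) xs
  where
  reflect : ∀ {z} → z ∉ ys → f z ∉ map f ys
  reflect z∉ fz∈ with ∈-map⁻ f fz∈
  ... | y , y∈ , fz≡fy rewrite f-inj fz≡fy = z∉ y∈

swapN-matchˡ : ∀ a b → swapN a b a ≡ b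
swapN-matchˡ a b with a ≟ a
... | yes _ = refl
... | no a≢a = ⊥-elim (a≢a refl)

swapN-matchʳ : ∀ a b → swapN a b b ≡ a
swapN-matchʳ a b with b ≟ a
... | yes b≡a = b≡a
... | no _ with b ≟ b
...   | yes _ = refl
...   | no b≢b = ⊥-elim (b≢b refl)

swapN-fix : ∀ {a b z} → z ≢ a → z ≢ b → swapN a b z ≡ z
swapN-fix {a} {b} {z} z≢a z≢b with z ≟ a
... | yes z≡a = ⊥-elim (z≢a z≡a)
... | no _ with z ≟ b
...   | yes z≡b = ⊥-elim (z≢b z≡b)
...   | no _ = refl

swapN-involutive : ∀ a b z → swapN a b (swapN a b z) ≡ z
swapN-involutive a b z with z ≟ a
... | yes refl = swapN-matchʳ z b
... | no z≢a with z ≟ b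
...   | yes refl = swapN-matchˡ a z
...   | no z≢b = swapN-fix z≢a z≢b

swapN-injective : ∀ a b → Injective _≡_ _≡_ (swapN a b)
swapN-injective a b {x} {y} eq =
  trans (sym (swapN-involutive a b x)) (trans (cong (swapN a b) eq) (swapN-involutive a b y))

restr-mapRanges : ∀ (g f : Name → Name) σ →
                  restr (map (λ p → g (proj₁ p) , map f (proj₂ p)) σ) ≡ map f (restr σ)
restr-mapRanges g f [] = refl
restr-mapRanges g f ((x , s) ∷ σ) =
  trans (cong (map f s ++_) (restr-mapRanges g f σ)) (sym (map-++ f s (restr σ)))

dom-swapB : ∀ a b σ → dom (swapB a b σ) ≡ map (swapN a b) (dom σ)
dom-swapB a b σ = trans (sym (map-∘ σ)) (map-∘ σ)

dom-swapRng : ∀ a b σ → dom (swapRng a b σ) ≡ dom σ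
dom-swapRng a b σ = sym (map-∘ σ)

an⊆fn : ∀ P → an P ⊆ fn P
an⊆fn (out x y P Q)  = xs⊆xs++ys (x ∷ []) _
an⊆fn (inp x y P)    = xs⊆xs++ys (x ∷ []) _
an⊆fn (close x)      = id
an⊆fn (wait x P)     = xs⊆xs++ys (x ∷ []) _
an⊆fn (selL x P)     = xs⊆xs++ys (x ∷ []) _
an⊆fn (selR x P)     = xs⊆xs++ys (x ∷ []) _
an⊆fn (branch x P Q) = xs⊆xs++ys (x ∷ []) _
an⊆fn (fwd x y)      = id
an⊆fn (new x P Q)    = filter⁺′ (λ z → ¬? (z ≟ x)) (λ z → ¬? (z ≟ x)) id (++⁺ (an⊆fn P) (an⊆fn Q))
an⊆fn (spawn σ P)    =
  ⊆-trans (++⁺ʳ (dom σ) (filter⁺′ (λ z → ¬? (z ∈? restr σ)) (λ z → ¬? (z ∈? restr σ)) id (an⊆fn P)))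
          (⊆-reflexive-↭ (++-comm (dom σ) _))

∉an : ∀ {z} P → z ∉ fn P → z ∉ an P
∉an P z∉fn = z∉fn ∘ an⊆fn P

an-new-new : ∀ {x y} P Q R → y ∉ an P → an (new x P (new y Q R)) ≡ ((an P ++ an Q ++ an R) ─ y) ─ x
an-new-new {x} P Q R y∉P = cong (_─ x) (sym (─-++-freshˡ (an P) _ y∉P))

an-spawn-spawn : ∀ σ₁ σ₂ Q → (∀ z → z ∈ dom σ₂ → z ∉ restr σ₁) →
                 an (spawn σ₁ (spawn σ₂ Q)) ≡ dom σ₁ ++ dom σ₂ ++ (an Q ∖ restr σ₂) ∖ restr σ₁
an-spawn-spawn σ₁ σ₂ Q disjoint = cong (dom σ₁ ++_)
  (trans (filter-++ (λ z → ¬? (z ∈? restr σ₁)) (dom σ₂) (an Q ∖ restr σ₂))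
         (cong (_++ (an Q ∖ restr σ₂) ∖ restr σ₁) (∖-fresh (dom σ₂) (restr σ₁) disjoint)))

module _ where
  open SetoidReasoning ([ set ]-Equality Name)

  an-swapP : ∀ a b P → an (swapP a b P) ∼[ set ] map (swapN a b) (an P)
  an-swapP a b (out x y P Q)  = ∼-refl
  an-swapP a b (inp x y P)    = ∼-refl
  an-swapP a b (close x)      = ∼-refl
  an-swapP a b (wait x P)     = ∼-refl
  an-swapP a b (selL x P)     = ∼-refl
  an-swapP a b (selR x P)     = ∼-refl
  an-swapP a b (branch x P Q) = ∼-refl
  an-swapP a b (fwd x y)      = ∼-refl
  an-swapP a b (new x P Q)    = begin
    (an (swapP a b P) ++ an (swapP a b Q)) ─ π x   ≈⟨ filter-cong _ (++-cong (an-swapP a b P) (an-swapP a b Q)) ⟩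
    (map π (an P) ++ map π (an Q)) ─ π x           ≡⟨ cong (_─ π x) (map-++ π (an P) (an Q)) ⟨
    map π (an P ++ an Q) ─ π x                     ≈⟨ map-─ (swapN-injective a b) (an P ++ an Q) x ⟨
    map π ((an P ++ an Q) ─ x)                     ∎
    where π = swapN a b
  an-swapP a b (spawn σ P)    = begin
    dom (swapB a b σ) ++ (an (swapP a b P) ∖ restr (swapB a b σ))
      ≡⟨ cong₂ (λ d r → d ++ (an (swapP a b P) ∖ r)) (dom-swapB a b σ) (restr-mapRanges π π σ) ⟩
    map π (dom σ) ++ (an (swapP a b P) ∖ map π (restr σ))
      ≈⟨ ++-congʳ (map π (dom σ)) (filter-cong _ (an-swapP a b P)) ⟩
    map π (dom σ) ++ (map π (an P) ∖ map π (restr σ))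
      ≈⟨ ++-congʳ (map π (dom σ)) (map-∖ (swapN-injective a b) (an P) (restr σ)) ⟨
    map π (dom σ) ++ map π (an P ∖ restr σ)
      ≡⟨ map-++ π (dom σ) _ ⟨
    map π (dom σ ++ (an P ∖ restr σ))
      ∎
    where π = swapN a b

  an-ν-exchange : ∀ {x y} P Q R → x ∉ fn Q → y ∉ fn P →
                  an (new x P (new y Q R)) ∼[ set ] an (new y Q (new x P R))
  an-ν-exchange {x} {y} P Q R x∉Q y∉P = begin
    an (new x P (new y Q R))            ≡⟨ an-new-new P Q R (∉an P y∉P) ⟩
    ((an P ++ an Q ++ an R) ─ y) ─ x    ≈⟨ ─-comm (an P ++ an Q ++ an R) x y ⟩
    ((an P ++ an Q ++ an R) ─ x) ─ y    ≈⟨ filter-cong _ (filter-cong _ (++-leftComm (an P) (an Q))) ⟩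
    ((an Q ++ an P ++ an R) ─ x) ─ y    ≡⟨ an-new-new Q P R (∉an Q x∉Q) ⟨
    an (new y Q (new x P R))            ∎

  an-ν-assoc : ∀ {x y} P Q R → x ∉ fn R → y ∉ fn P →
               an (new x P (new y Q R)) ∼[ set ] an (new y (new x P Q) R)
  an-ν-assoc {x} {y} P Q R x∉R y∉P = begin
    an (new x P (new y Q R))            ≡⟨ an-new-new P Q R (∉an P y∉P) ⟩
    ((an P ++ an Q ++ an R) ─ y) ─ x    ≈⟨ ─-comm (an P ++ an Q ++ an R) x y ⟩
    ((an P ++ an Q ++ an R) ─ x) ─ y    ≡⟨ cong (λ l → (l ─ x) ─ y) (++-assoc (an P) (an Q) (an R)) ⟨
    (((an P ++ an Q) ++ an R) ─ x) ─ y  ≡⟨ cong (_─ y) (─-++-freshʳ (an P ++ an Q) (an R) (∉an R x∉R)) ⟩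
    an (new y (new x P Q) R)            ∎

  an-spawn-exchange : ∀ {σ₁ σ₂} Q → Independent σ₁ σ₂ →
                      an (spawn σ₁ (spawn σ₂ Q)) ∼[ set ] an (spawn σ₂ (spawn σ₁ Q))
  an-spawn-exchange {σ₁} {σ₂} Q (_ , dom₁#restr₂ , _ , dom₂#restr₁) = begin
    an (spawn σ₁ (spawn σ₂ Q))
      ≡⟨ an-spawn-spawn σ₁ σ₂ Q dom₂#restr₁ ⟩
    dom σ₁ ++ dom σ₂ ++ (an Q ∖ restr σ₂) ∖ restr σ₁
      ≈⟨ ++-leftComm (dom σ₁) (dom σ₂) ⟩
    dom σ₂ ++ dom σ₁ ++ (an Q ∖ restr σ₂) ∖ restr σ₁
      ≈⟨ ++-congʳ (dom σ₂) (++-congʳ (dom σ₁) (∖-comm (an Q) (restr σ₂) (restr σ₁))) ⟩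
    dom σ₂ ++ dom σ₁ ++ (an Q ∖ restr σ₁) ∖ restr σ₂
      ≡⟨ an-spawn-spawn σ₂ σ₁ Q dom₁#restr₂ ⟨
    an (spawn σ₂ (spawn σ₁ Q))
      ∎

  an-α-new : ∀ {x z} P Q → z ∉ fn P → z ∉ fn Q →
             an (new z (swapP x z P) (swapP x z Q)) ∼[ set ] an (new x P Q)
  an-α-new {x} {z} P Q z∉P z∉Q = begin
    (an (swapP x z P) ++ an (swapP x z Q)) ─ z
      ≈⟨ filter-cong _ (++-cong (an-swapP x z P) (an-swapP x z Q)) ⟩
    (map π (an P) ++ map π (an Q)) ─ z
      ≡⟨ cong₂ _─_ (map-++ π (an P) (an Q)) (swapN-matchˡ x z) ⟨
    map π (an P ++ an Q) ─ π x
      ≈⟨ map-─ (swapN-injective x z) (an P ++ an Q) x ⟨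
    map π ((an P ++ an Q) ─ x)
      ≡⟨ map-id-local (tabulate π-fixes) ⟩
    (an P ++ an Q) ─ x
      ∎
    where
    π = swapN x z
    π-fixes : ∀ {w} → w ∈ (an P ++ an Q) ─ x → π w ≡ w
    π-fixes {w} w∈ with ∈-filter⁻ (λ v → ¬? (v ≟ x)) {xs = an P ++ an Q} w∈
    ... | w∈PQ , w≢x = swapN-fix w≢x λ { refl → [ ∉an P z∉P , ∉an Q z∉Q ] (∈-++⁻ (an P) w∈PQ) }

  an-α-spawn : ∀ {a b} σ P → a ∈ restr σ → b ∉ fn P →
               an (spawn (swapRng a b σ) (swapP a b P)) ∼[ set ] an (spawn σ P)
  an-α-spawn {a} {b} σ P a∈σ b∉P = begin
    dom (swapRng a b σ) ++ (an (swapP a b P) ∖ restr (swapRng a b σ))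
      ≡⟨ cong₂ (λ d r → d ++ (an (swapP a b P) ∖ r)) (dom-swapRng a b σ) (restr-mapRanges id π σ) ⟩
    dom σ ++ (an (swapP a b P) ∖ map π (restr σ))
      ≈⟨ ++-congʳ (dom σ) (filter-cong _ (an-swapP a b P)) ⟩
    dom σ ++ (map π (an P) ∖ map π (restr σ))
      ≈⟨ ++-congʳ (dom σ) (map-∖ (swapN-injective a b) (an P) (restr σ)) ⟨
    dom σ ++ map π (an P ∖ restr σ)
      ≡⟨ cong (dom σ ++_) (map-id-local (tabulate π-fixes)) ⟩
    dom σ ++ (an P ∖ restr σ)
      ∎
    where
    π = swapN a b
    π-fixes : ∀ {w} → w ∈ an P ∖ restr σ → π w ≡ w
    π-fixes {w} w∈ with ∈-filter⁻ (λ v → ¬? (v ∈? restr σ)) {xs = an P} w∈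
    ... | w∈P , w∉σ = swapN-fix (λ { refl → w∉σ a∈σ }) (λ { refl → ∉an P b∉P w∈P })

  an-resp-≡s : ∀ {P Q} → P ≡s Q → an P ∼[ set ] an Q
  an-resp-≡s s-refl              = ∼-refl
  an-resp-≡s (s-sym P≡Q)         = ∼-sym (an-resp-≡s P≡Q)
  an-resp-≡s (s-trans P≡Q Q≡R)   = ∼-trans (an-resp-≡s P≡Q) (an-resp-≡s Q≡R)
  an-resp-≡s (c-out _ _)         = ∼-refl
  an-resp-≡s (c-inp _)           = ∼-refl
  an-resp-≡s (c-wait _)          = ∼-refl
  an-resp-≡s (c-selL _)          = ∼-refl
  an-resp-≡s (c-selR _)          = ∼-refl
  an-resp-≡s (c-branch _ _)      = ∼-refl
  an-resp-≡s (c-new P≡P′ Q≡Q′)   = filter-cong _ (++-cong (an-resp-≡s P≡P′) (an-resp-≡s Q≡Q′))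
  an-resp-≡s (c-spawn {σ} P≡P′)  = ++-congʳ (dom σ) (filter-cong _ (an-resp-≡s P≡P′))
  an-resp-≡s (ax-nu1 {P = P} {Q} {R} x∉Q y∉P)  = an-ν-exchange P Q R x∉Q y∉P
  an-resp-≡s (ax-nu2 {P = P} {Q} {R} x∉R y∉P)  = an-ν-assoc P Q R x∉R y∉P
  an-resp-≡s (ax-spawn {Q = Q} indep)          = an-spawn-exchange Q indep
  an-resp-≡s (α-out _)                         = ∼-refl
  an-resp-≡s (α-inp _)                         = ∼-refl
  an-resp-≡s (α-new {P = P} {Q} z∉P z∉Q)       = ∼-sym (an-α-new P Q z∉P z∉Q)
  an-resp-≡s (α-spawn {σ} {P = P} a∈σ b∉P _ _) = ∼-sym (an-α-spawn σ P a∈σ b∉P)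

lemmaA10 : (P Q : Proc) → WF P → WF Q → P ≡s Q →
    (∀ z → (z ∈ an P → z ∈ an Q) × (z ∈ an Q → z ∈ an P))
lemmaA10 P Q _ _ P≡Q z = to , from
  where open Equivalence (an-resp-≡s P≡Q {z})
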